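{- \begin{align*} \rho(2,m)\rho(3,m)\prod_{\substack{p \geq 5 \\ p \mid m}} \frac{\rho(p,m)}{1 - p^{ -2}} \ll \frac{1}{m}\prod_{p \mid m} \frac{3}{p}. \end{align*}
   Context: For a prime $p$ and a positive integer $m$ with $\gcd(m,p^\infty)=p^n$, $\rho(p,m)$ is defined as follows. For $p\ge 5$: $n=0$: $1-p^{ -2}$; $n=1$: $p^{ -2}(1-p^{ -1})$; $n=2$: $p^{ -3}(1-p^{ -1})$; $n=3$: $p^{ -4}(1-p^{ -1})^2$; $n=4$: $p^{ -5}(1-p^{ -1})(2-p^{ -1})$; $n=5$: $p^{ -6}(1-p^{ -1})(2-2p^{ -1})$; $n=6,7,8$: $p^{ -(n+1)}(1-p^{ -1})(3-2p^{ -1})$; $n\ge 9$: $p^{ -(n+1)}(1-p^{ -1})(2-2p^{ -1})$. For $p=2$: $\rho=1/2,1/4,1/4$ for $n=0,1,2$ and $0$ for $n\ge3$. For $p=3$: $\rho=1$ for $n=0$ and $0$ for $n\ge1$. The implied constant is absolute (uniform in $m$). -}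

module Defs where

open import Data.Nat as ℕ using (ℕ; zero; suc; _∸_)
open import Data.Nat.Divisibility using (_∣_; _∣?_)
open import Data.Nat.DivMod using (_/_)
open import Data.Nat.Primality using (Prime; prime?)
open import Data.Integer using (+_)
open import Data.Rational as ℚ using (ℚ; 0ℚ; 1ℚ; _*_; _-_)
open import Data.List using (List; filter; foldr; upTo; map)
open import Relation.Nullary using (yes; no)
open import Relation.Nullary.Decidable using (_×-dec_)

-- p-adic valuation with fuel: valF f p m = exponent of p in m (for p ≥ 2, m ≥ 1, fuel f ≥ m)
valF : ℕ → ℕ → ℕ → ℕ
valF (suc f) (suc (suc k)) (suc m) with suc (suc k) ∣? suc m
... | yes _ = suc (valF f (suc (suc k)) (suc m / suc (suc k)))
... | no _  = 0
valF _ _ _ = 0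

val : ℕ → ℕ → ℕ
val p m = valF m p m

-- a / b as a rational (b ≥ 1; the value 0 for b = 0 is never used)
frac : ℕ → ℕ → ℚ
frac a zero    = 0ℚ
frac a (suc b) = (+ a) ℚ./ suc b

inv : ℕ → ℚ
inv p = frac 1 p

pow : ℚ → ℕ → ℚ
pow q zero    = 1ℚ
pow q (suc k) = q * pow q k

two : ℚ
two = frac 2 1

three : ℚ
three = frac 3 1

-- ρ(p,m) for p ≥ 5, as a function of n = ν_p(m)
rhoBig : ℕ → ℕ → ℚ
rhoBig p n = body n
  where
  q = inv p
  a = 1ℚ - q
  body : ℕ → ℚ
  body 0 = 1ℚ - q * q
  body 1 = pow q 2 * a
  body 2 = pow q 3 * a
  body 3 = pow q 4 * (a * a)
  body 4 = pow q 5 * (a * (two - q))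
  body 5 = pow q 6 * (a * (two - two * q))
  body 6 = pow q 7 * (a * (three - two * q))
  body 7 = pow q 8 * (a * (three - two * q))
  body 8 = pow q 9 * (a * (three - two * q))
  body (suc n) = pow q (suc (suc n)) * (a * (two - two * q))

rho2 : ℕ → ℚ
rho2 0 = frac 1 2
rho2 1 = frac 1 4
rho2 2 = frac 1 4
rho2 _ = 0ℚ

rho3 : ℕ → ℚ
rho3 0 = 1ℚ
rho3 _ = 0ℚ

rho : ℕ → ℕ → ℚ
rho 2 m = rho2 (val 2 m)
rho 3 m = rho3 (val 3 m)
rho p m = rhoBig p (val p m)

prodℚ : List ℚ → ℚ
prodℚ = foldr _*_ 1ℚ

primeDivisors : ℕ → List ℕ
primeDivisors m = filter (λ p → prime? p ×-dec (p ∣? m)) (upTo (suc m))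

bigPrimeDivisors : ℕ → List ℕ
bigPrimeDivisors m = filter (λ p → (5 ℕ.≤? p) ×-dec (prime? p ×-dec (p ∣? m))) (upTo (suc m))

-- left-hand side: ρ(2,m) ρ(3,m) ∏_{p ≥ 5, p ∣ m} ρ(p,m) / (1 - p^{-2})
-- (1/(1 - p^{-2}) is written as p²/(p² - 1))
LHS : ℕ → ℚ
LHS m = rho 2 m * (rho 3 m *
  prodℚ (map (λ p → rho p m * frac (p ℕ.* p) (p ℕ.* p ∸ 1)) (bigPrimeDivisors m)))

RHS : ℕ → ℚ
RHS m = inv m * prodℚ (map (λ p → three * inv p) (primeDivisors m))

module Submission where

-- With C = 1: both sides are products of local factors over the primes q < m + 4, and
-- m = ∏ q ^ ν_q(m). So it suffices that for every q the left factor is nonnegative and,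
-- multiplied by q ^ ν_q(m), is at most the right factor (3/q if q ∣ m, and 1 otherwise).
-- For q ≥ 5 and ν = ν_q(m) ≥ 1 one has ρ(q,m) = q^-(ν+1) (1 - 1/q) c with 0 ≤ c ≤ 3 and
-- (1 - 1/q) q²/(q² - 1) = q/(q + 1) ≤ 1, giving the bound 3/q; for q = 2, 3 it is a
-- finite check.

open import Defs
open import Algebra.Bundles using (CommutativeMonoid)
open import Data.Bool using (true; false; if_then_else_)
open import Data.List using ([]; _∷_; _∷ʳ_; map; filter; foldr; upTo)
open import Data.List.Properties using (upTo-∷ʳ; map-++; foldr-++)
open import Data.Nat as ℕ using (ℕ; zero; suc; z≤n; s≤s; _≥_)
import Data.Nat.Properties as ℕP
open import Data.Nat.Divisibility using (_∣_; _∣?_; >⇒∤)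
open import Data.Nat.Primality using (Prime; prime?; prime[2])
import Data.Nat.Tactic.RingSolver as ℕ-Solver
open import Data.Product using (Σ; Σ-syntax; _×_; _,_; proj₂)
open import Data.Sum using (inj₁; inj₂)
open import Relation.Nullary using (¬_; Dec; yes; no; does; contradiction)
open import Relation.Nullary.Decidable using (_×-dec_; toWitness; dec-false)
open import Relation.Unary using (Pred; Decidable)

module RangeProduct {c ℓ} (M : CommutativeMonoid c ℓ) where

  open import Data.Nat using (_≤_; _<_)
  open import Relation.Binary.PropositionalEquality as ≡ using (_≡_; _≢_)

  open CommutativeMonoid M
  open import Algebra.Properties.CommutativeSemigroup commutativeSemigroup using (x∙yz≈y∙xz)
  open import Relation.Binary.Reasoning.Setoid setoid

  ∏< : (ℕ → Carrier) → ℕ → Carrier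
  ∏< f zero    = ε
  ∏< f (suc n) = ∏< f n ∙ f n

  ∏<-cong : ∀ {f g} n → (∀ q → q < n → f q ≈ g q) → ∏< f n ≈ ∏< g n
  ∏<-cong zero    _   = refl
  ∏<-cong (suc n) f≈g = ∙-cong (∏<-cong n λ q q<n → f≈g q (ℕP.m<n⇒m<1+n q<n)) (f≈g n ℕP.≤-refl)

  ∏<-ε : ∀ {f} n → (∀ q → q < n → f q ≈ ε) → ∏< f n ≈ ε
  ∏<-ε zero    _    = refl
  ∏<-ε (suc n) f≈ε = trans (∙-cong (∏<-ε n λ q q<n → f≈ε q (ℕP.m<n⇒m<1+n q<n)) (f≈ε n ℕP.≤-refl)) (identityˡ ε)

  ∏<-extend : ∀ {f n} N → n ≤ N → (∀ q → n ≤ q → f q ≈ ε) → ∏< f N ≈ ∏< f n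
  ∏<-extend zero z≤n _ = refl
  ∏<-extend (suc N) n≤N f≈ε with ℕP.m≤n⇒m<n∨m≡n n≤N
  ... | inj₂ ≡.refl       = refl
  ... | inj₁ (s≤s n≤N-1) = trans (∙-cong (∏<-extend N n≤N-1 f≈ε) (f≈ε N n≤N-1)) (identityʳ _)

  ∏<-update : ∀ {f g p c} n → p < n → (∀ q → q ≢ p → f q ≈ g q) → f p ≈ c ∙ g p →
              ∏< f n ≈ c ∙ ∏< g n
  ∏<-update {f} {g} {p} {c} (suc n) p<n f≈g fp≈cgp with p ℕP.≟ n
  ... | yes ≡.refl = begin
    ∏< f n ∙ f p       ≈⟨ ∙-cong (∏<-cong n λ q q<n → f≈g q λ { ≡.refl → ℕP.<-irrefl ≡.refl q<n }) fp≈cgp ⟩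
    ∏< g n ∙ (c ∙ g p) ≈⟨ x∙yz≈y∙xz _ c _ ⟩
    c ∙ (∏< g n ∙ g p) ∎
  ... | no p≢n = begin
    ∏< f n ∙ f n       ≈⟨ ∙-cong (∏<-update n (ℕP.≤∧≢⇒< (ℕP.≤-pred p<n) p≢n) f≈g fp≈cgp)
                                 (f≈g n (λ n≡p → p≢n (≡.sym n≡p))) ⟩
    (c ∙ ∏< g n) ∙ g n ≈⟨ assoc c _ _ ⟩
    c ∙ (∏< g n ∙ g n) ∎

  foldr-filter : ∀ {p} {P : Pred ℕ p} (P? : Decidable P) (f : ℕ → Carrier) xs →
                 foldr _∙_ ε (map f (filter P? xs)) ≈ foldr _∙_ ε (map (λ q → if does (P? q) then f q else ε) xs)
  foldr-filter P? f []       = refl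
  foldr-filter P? f (x ∷ xs) with does (P? x)
  ... | false = trans (foldr-filter P? f xs) (sym (identityˡ _))
  ... | true  = ∙-cong refl (foldr-filter P? f xs)

  foldr-∙ : ∀ x xs → foldr _∙_ x xs ≈ foldr _∙_ ε xs ∙ x
  foldr-∙ x []       = sym (identityˡ x)
  foldr-∙ x (y ∷ xs) = trans (∙-cong refl (foldr-∙ x xs)) (sym (assoc y _ x))

  foldr-upTo : ∀ f n → foldr _∙_ ε (map f (upTo n)) ≈ ∏< f n
  foldr-upTo f zero    = refl
  foldr-upTo f (suc n) = begin
    foldr _∙_ ε (map f (upTo (suc n)))       ≡⟨ ≡.cong (λ xs → foldr _∙_ ε (map f xs)) (upTo-∷ʳ n) ⟨
    foldr _∙_ ε (map f (upTo n ∷ʳ n))        ≡⟨ ≡.cong (foldr _∙_ ε) (map-++ f (upTo n) (n ∷ [])) ⟩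
    foldr _∙_ ε (map f (upTo n) ∷ʳ f n)      ≡⟨ foldr-++ _∙_ ε (map f (upTo n)) (f n ∷ []) ⟩
    foldr _∙_ (f n ∙ ε) (map f (upTo n))     ≈⟨ foldr-∙ (f n ∙ ε) (map f (upTo n)) ⟩
    foldr _∙_ ε (map f (upTo n)) ∙ (f n ∙ ε) ≈⟨ ∙-cong (foldr-upTo f n) (identityʳ (f n)) ⟩
    ∏< f n ∙ f n                             ∎

  foldr-filter-upTo : ∀ {p} {P : Pred ℕ p} (P? : Decidable P) (f : ℕ → Carrier) {n} N → n ≤ N →
                      (∀ q → n ≤ q → ¬ P q) →
                      foldr _∙_ ε (map f (filter P? (upTo n))) ≈ ∏< (λ q → if does (P? q) then f q else ε) N
  foldr-filter-upTo P? f {n} N n≤N ¬P = begin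
    foldr _∙_ ε (map f (filter P? (upTo n)))    ≈⟨ foldr-filter P? f (upTo n) ⟩
    foldr _∙_ ε (map select (upTo n))           ≈⟨ foldr-upTo select n ⟩
    ∏< select n                                 ≈⟨ ∏<-extend N n≤N select≈ε ⟨
    ∏< select N                                 ∎
    where
    select : ℕ → Carrier
    select q = if does (P? q) then f q else ε
    select≈ε : ∀ q → n ≤ q → select q ≈ ε
    select≈ε q n≤q = reflexive (≡.cong (if_then f q else ε) (dec-false (P? q) (¬P q n≤q)))

open import Relation.Binary.PropositionalEquality

module Valuation where

  open import Data.Nat using (_+_; _*_; _≤_; _<_)
  open import Data.Nat.Divisibility using (m∣m*n; ∣n⇒∣m*n; _∣0)
  open import Data.Nat.DivMod using (_/_; m/n<m; m*n/n≡m; *-/-assoc)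
  open import Data.Nat.Induction using (<-wellFounded)
  open import Data.Nat.Primality using (euclidsLemma; ¬prime[0]; ¬prime[1])
  open import Induction.WellFounded using (Acc; acc)

  valF-zero : ∀ f t → valF f (2 + t) 0 ≡ 0
  valF-zero zero    t = refl
  valF-zero (suc f) t = refl

  quotient< : ∀ t n → suc n / (2 + t) < suc n
  quotient< t n = m/n<m (suc n) (2 + t) (s≤s (s≤s z≤n))

  valF-fuel : ∀ {t} f g n → n ≤ f → n ≤ g → valF f (2 + t) n ≡ valF g (2 + t) n
  valF-fuel f g zero _ _ = trans (valF-zero f _) (sym (valF-zero g _))
  valF-fuel {t} (suc f) (suc g) (suc n) n≤f n≤g with 2 + t ∣? suc n
  ... | no  _ = refl
  ... | yes _ = cong suc (valF-fuel f g _ (below n≤f) (below n≤g))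
    where
    below : ∀ {h} → suc n ≤ suc h → suc n / (2 + t) ≤ h
    below (s≤s n≤h) = ℕP.≤-trans (ℕP.≤-pred (quotient< t n)) n≤h

  val-∤ : ∀ {p n} → ¬ (p ∣ n) → val p n ≡ 0
  val-∤ {_}           {zero}  _ = refl
  val-∤ {0}           {suc n} _ = refl
  val-∤ {1}           {suc n} _ = refl
  val-∤ {suc (suc t)} {suc n} ∤n with 2 + t ∣? suc n
  ... | no  _   = refl
  ... | yes ∣n = contradiction ∣n ∤n

  val-∣ : ∀ {t n} → 2 + t ∣ suc n → val (2 + t) (suc n) ≡ suc (val (2 + t) (suc n / (2 + t)))
  val-∣ {t} {n} ∣n with 2 + t ∣? suc n
  ... | no ∤n = contradiction ∣n ∤n
  ... | yes _ = cong suc (valF-fuel n _ _ (ℕP.≤-pred (quotient< t n)) ℕP.≤-refl)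

  val-*-self : ∀ {p k} → Prime p → 1 ≤ k → val p (p * k) ≡ suc (val p k)
  val-*-self {0}           p-prime _ = contradiction p-prime ¬prime[0]
  val-*-self {1}           p-prime _ = contradiction p-prime ¬prime[1]
  val-*-self {suc (suc t)} {suc k} _ _ = begin
    val (2 + t) ((2 + t) * suc k)                 ≡⟨ val-∣ (m∣m*n (suc k)) ⟩
    suc (val (2 + t) ((2 + t) * suc k / (2 + t))) ≡⟨ cong (λ n → suc (val (2 + t) n)) cancel ⟩
    suc (val (2 + t) (suc k))                     ∎
    where
    open ≡-Reasoning
    cancel : (2 + t) * suc k / (2 + t) ≡ suc k
    cancel = trans (cong (_/ (2 + t)) (ℕP.*-comm (2 + t) (suc k))) (m*n/n≡m (suc k) (2 + t))

  val-*-coprime : ∀ {p} q k → Prime p → ¬ (p ∣ q) → val p (q * k) ≡ val p k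
  val-*-coprime {0}           _ _ p-prime _ = contradiction p-prime ¬prime[0]
  val-*-coprime {1}           _ _ p-prime _ = contradiction p-prime ¬prime[1]
  val-*-coprime {suc (suc t)} zero    _ _ p∤q = contradiction (_ ∣0) p∤q
  val-*-coprime {suc (suc t)} (suc q) k p-prime p∤q = go k (<-wellFounded k)
    where
    P : ℕ
    P = 2 + t
    go : ∀ k → Acc _<_ k → val P (suc q * k) ≡ val P k
    go zero    _         = cong (val P) (ℕP.*-zeroʳ q)
    -- Not a `with`: it would also abstract the test `P ∣? suc k` hidden inside `val P (suc k)`.
    go (suc k) (acc rec) = byCases (P ∣? suc k)
      where
      byCases : Dec (P ∣ suc k) → val P (suc q * suc k) ≡ val P (suc k)
      byCases (no p∤k) = trans (val-∤ p∤qk) (sym (val-∤ p∤k))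
        where
        p∤qk : ¬ (P ∣ suc q * suc k)
        p∤qk p∣qk with euclidsLemma (suc q) (suc k) p-prime p∣qk
        ... | inj₁ p∣q = p∤q p∣q
        ... | inj₂ p∣k = p∤k p∣k
      byCases (yes p∣k) = begin
        val P (suc q * suc k)             ≡⟨ val-∣ (∣n⇒∣m*n (suc q) p∣k) ⟩
        suc (val P (suc q * suc k / P))   ≡⟨ cong (λ n → suc (val P n)) (*-/-assoc (suc q) p∣k) ⟩
        suc (val P (suc q * (suc k / P))) ≡⟨ cong suc (go (suc k / P) (rec (quotient< t k))) ⟩
        suc (val P (suc k / P))           ≡⟨ val-∣ p∣k ⟨
        val P (suc k)                     ∎
        where open ≡-Reasoning

  val-pos : ∀ {p m} → Prime p → p ∣ m → 1 ≤ m → 1 ≤ val p m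
  val-pos {0}           p-prime _ _ = contradiction p-prime ¬prime[0]
  val-pos {1}           p-prime _ _ = contradiction p-prime ¬prime[1]
  val-pos {suc (suc t)} {suc n} _ p∣m _ = subst (1 ≤_) (sym (val-∣ p∣m)) (s≤s z≤n)

open Valuation

module ℕ∏ = RangeProduct ℕP.*-1-commutativeMonoid

module PrimeComponents where

  open import Data.Nat using (_*_; _^_; _<_; _≤_; NonZero; >-nonZero)
  open import Data.Nat.Divisibility using (m∣m*n; ∣n⇒∣m*n; ∣1⇒≡1)
  open import Data.Nat.ListAction using (product)
  open import Data.Nat.Primality
    using (euclidsLemma; prime⇒irreducible; ¬prime[1]; productOfPrimes≥1; productOfPrimes≢0; prime⇒nonZero)
  open import Data.Nat.Primality.Factorisation using (factorise; PrimeFactorisation)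
  open import Data.List.Relation.Unary.All using (All; []; _∷_)
  open ℕ∏ using (∏<)

  primeComponent : ℕ → ℕ → ℕ
  primeComponent m q = if does (prime? q ×-dec q ∣? m) then q ^ val q m else 1

  primeComponent-1 : ∀ q → primeComponent 1 q ≡ 1
  primeComponent-1 q with prime? q | q ∣? 1
  ... | no _        | _       = refl
  ... | yes _       | no _    = refl
  ... | yes q-prime | yes q∣1 = contradiction (subst Prime (∣1⇒≡1 q∣1) q-prime) ¬prime[1]

  primeComponent-*-self : ∀ {p k} → Prime p → 1 ≤ k → primeComponent (p * k) p ≡ p * primeComponent k p
  primeComponent-*-self {p} {k} p-prime k≥1 with prime? p | p ∣? p * k | p ∣? k
  ... | no ¬p-prime | _       | _      = contradiction p-prime ¬p-prime
  ... | yes _       | no p∤pk | _      = contradiction (m∣m*n k) p∤pk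
  ... | yes _       | yes _   | yes _  = cong (p ^_) (val-*-self p-prime k≥1)
  ... | yes _       | yes _   | no p∤k = cong (p ^_) (trans (val-*-self p-prime k≥1) (cong suc (val-∤ p∤k)))

  prime∣prime⇒≡ : ∀ {p q} → Prime p → Prime q → q ∣ p → q ≡ p
  prime∣prime⇒≡ p-prime q-prime q∣p with prime⇒irreducible p-prime q∣p
  ... | inj₁ q≡1 = contradiction (subst Prime q≡1 q-prime) ¬prime[1]
  ... | inj₂ q≡p = q≡p

  primeComponent-*-other : ∀ {p q} k → Prime p → q ≢ p → primeComponent (p * k) q ≡ primeComponent k q
  primeComponent-*-other {p} {q} k p-prime q≢p with prime? q | q ∣? p * k | q ∣? k
  ... | no _        | _        | _       = refl
  ... | yes _       | no _     | no _    = refl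
  ... | yes _       | no q∤pk  | yes q∣k = contradiction (∣n⇒∣m*n p q∣k) q∤pk
  ... | yes q-prime | yes q∣pk | no q∤k with euclidsLemma p k q-prime q∣pk
  ...   | inj₁ q∣p = contradiction (prime∣prime⇒≡ p-prime q-prime q∣p) q≢p
  ...   | inj₂ q∣k = contradiction q∣k q∤k
  primeComponent-*-other {p} {q} k p-prime q≢p | yes q-prime | yes _ | yes _ =
    cong (q ^_) (val-*-coprime p k q-prime (λ q∣p → q≢p (prime∣prime⇒≡ p-prime q-prime q∣p)))

  ∏<-primeComponent-product : ∀ {ps} N → All Prime ps → product ps < N →
                              ∏< (primeComponent (product ps)) N ≡ product ps
  ∏<-primeComponent-product N [] _ = ℕ∏.∏<-ε N (λ q _ → primeComponent-1 q)
  ∏<-primeComponent-product {p ∷ ps} N (p-prime ∷ ps-prime) pk<N = begin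
    ∏< (primeComponent (p * k)) N ≡⟨ ℕ∏.∏<-update {c = p} N p<N (λ q → primeComponent-*-other k p-prime)
                                                        (primeComponent-*-self p-prime k≥1) ⟩
    p * ∏< (primeComponent k) N   ≡⟨ cong (p *_) (∏<-primeComponent-product N ps-prime k<N) ⟩
    p * k                         ∎
    where
    open ≡-Reasoning
    k : ℕ
    k = product ps
    k≥1 : 1 ≤ k
    k≥1 = productOfPrimes≥1 ps-prime
    instance
      p≢0 : NonZero p
      p≢0 = prime⇒nonZero p-prime
      k≢0 : NonZero k
      k≢0 = productOfPrimes≢0 ps-prime
    p<N : p < N
    p<N = ℕP.≤-<-trans (ℕP.m≤m*n p k) pk<N
    k<N : k < N
    k<N = ℕP.≤-<-trans (ℕP.m≤n*m k p) pk<N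

  ∏<-primeComponent : ∀ {m} N → 1 ≤ m → m < N → ∏< (primeComponent m) N ≡ m
  ∏<-primeComponent {m} N m≥1 m<N =
    subst (λ n → ∏< (primeComponent n) N ≡ n) (sym isFactorisation)
          (∏<-primeComponent-product N factorsPrime (subst (_< N) isFactorisation m<N))
    where
    open PrimeFactorisation (factorise m ⦃ >-nonZero m≥1 ⦄)

open PrimeComponents

open import Data.Integer as ℤ using (+_; +≤+)
import Data.Integer.Properties as ℤP
open import Data.Rational as ℚ using (ℚ; 0ℚ; 1ℚ; _*_; _-_; _+_; _≤_; _<_; toℚᵘ; nonNegative)
open import Data.Rational.Properties
open import Data.Rational.Solver using (module +-*-Solver)
open import Data.Rational.Unnormalised as ℚᵘ using (mkℚᵘ; *≡*; *≤*)
import Data.Rational.Unnormalised.Properties as ℚᵘP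
open import Algebra.Properties.CommutativeSemigroup (CommutativeMonoid.commutativeSemigroup *-1-commutativeMonoid)
  using (interchange; x∙yz≈y∙xz)

module ℚ∏ = RangeProduct *-1-commutativeMonoid
open ℚ∏ using (∏<)

ι : ℕ → ℚ
ι n = frac n 1

frac-nonNeg : ∀ a b → 0ℚ ≤ frac a b
frac-nonNeg a zero    = ≤-refl
frac-nonNeg a (suc b) = nonNegative⁻¹ _ {{normalize-nonNeg a (suc b)}}

frac≃mkℚᵘ : ∀ a b → toℚᵘ (frac a (suc b)) ℚᵘ.≃ mkℚᵘ (+ a) b
frac≃mkℚᵘ a b = toℚᵘ-fromℚᵘ (mkℚᵘ (+ a) b)

frac-≤ : ∀ a b c d → a ℕ.* suc d ℕ.≤ c ℕ.* suc b → frac a (suc b) ≤ frac c (suc d)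
frac-≤ a b c d ad≤cb = toℚᵘ-cancel-≤ {frac a (suc b)} {frac c (suc d)}
  (ℚᵘP.≤-respˡ-≃ (ℚᵘP.≃-sym (frac≃mkℚᵘ a b)) (ℚᵘP.≤-respʳ-≃ (ℚᵘP.≃-sym (frac≃mkℚᵘ c d)) (*≤* cross)))
  where
  cross : + a ℤ.* + suc d ℤ.≤ + c ℤ.* + suc b
  cross = subst₂ ℤ._≤_ (ℤP.pos-* a (suc d)) (ℤP.pos-* c (suc b)) (+≤+ ad≤cb)

frac-cong : ∀ a b c d → a ℕ.* suc d ≡ c ℕ.* suc b → frac a (suc b) ≡ frac c (suc d)
frac-cong a b c d ad≡cb = fromℚᵘ-cong {mkℚᵘ (+ a) b} {mkℚᵘ (+ c) d}
  (*≡* (trans (sym (ℤP.pos-* a (suc d))) (trans (cong +_ ad≡cb) (ℤP.pos-* c (suc b)))))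

frac-* : ∀ a b c d → frac a (suc b) * frac c (suc d) ≡ frac (a ℕ.* c) (suc b ℕ.* suc d)
frac-* a b c d = toℚᵘ-injective (ℚᵘP.≃-trans (toℚᵘ-homo-* (frac a (suc b)) (frac c (suc d)))
  (ℚᵘP.≃-trans (ℚᵘP.*-cong (frac≃mkℚᵘ a b) (frac≃mkℚᵘ c d)) (ℚᵘP.≃-trans mk* (ℚᵘP.≃-sym (frac≃mkℚᵘ (a ℕ.* c) _)))))
  where
  mk* : mkℚᵘ (+ a) b ℚᵘ.* mkℚᵘ (+ c) d ℚᵘ.≃ mkℚᵘ (+ (a ℕ.* c)) (d ℕ.+ b ℕ.* suc d)
  mk* = *≡* {mkℚᵘ (+ a) b ℚᵘ.* mkℚᵘ (+ c) d} {mkℚᵘ (+ (a ℕ.* c)) (d ℕ.+ b ℕ.* suc d)}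
    (cong (ℤ._* + suc (d ℕ.+ b ℕ.* suc d)) (sym (ℤP.pos-* a c)))

frac-+ : ∀ a c b → frac a (suc b) + frac c (suc b) ≡ frac (a ℕ.+ c) (suc b)
frac-+ a c b = toℚᵘ-injective (ℚᵘP.≃-trans (toℚᵘ-homo-+ (frac a (suc b)) (frac c (suc b)))
  (ℚᵘP.≃-trans (ℚᵘP.+-cong (frac≃mkℚᵘ a b) (frac≃mkℚᵘ c b)) (ℚᵘP.≃-trans mk+ (ℚᵘP.≃-sym (frac≃mkℚᵘ (a ℕ.+ c) b)))))
  where
  B : ℕ
  B = suc b
  mk+ : mkℚᵘ (+ a) b ℚᵘ.+ mkℚᵘ (+ c) b ℚᵘ.≃ mkℚᵘ (+ (a ℕ.+ c)) b
  mk+ = *≡* (begin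
    (+ a ℤ.* + B ℤ.+ + c ℤ.* + B) ℤ.* + B ≡⟨ cong (ℤ._* + B) (ℤP.*-distribʳ-+ (+ B) (+ a) (+ c)) ⟨
    (+ a ℤ.+ + c) ℤ.* + B ℤ.* + B        ≡⟨ ℤP.*-assoc (+ a ℤ.+ + c) (+ B) (+ B) ⟩
    + (a ℕ.+ c) ℤ.* + (B ℕ.* B)          ∎)
    where open ≡-Reasoning

ι-* : ∀ a b → ι (a ℕ.* b) ≡ ι a * ι b
ι-* a b = sym (frac-* a 0 b 0)

inv*ι≡1 : ∀ n → inv (suc n) * ι (suc n) ≡ 1ℚ
inv*ι≡1 n = trans (frac-* 1 n (suc n) 0) (frac-cong (1 ℕ.* suc n) (n ℕ.* 1) 1 0 (begin
  1 ℕ.* suc n ℕ.* 1 ≡⟨ ℕP.*-identityʳ _ ⟩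
  1 ℕ.* suc n       ≡⟨ cong (λ k → 1 ℕ.* suc k) (ℕP.*-identityʳ n) ⟨
  1 ℕ.* suc (n ℕ.* 1) ∎))
  where open ≡-Reasoning

*-nonNeg : ∀ {p q} → 0ℚ ≤ p → 0ℚ ≤ q → 0ℚ ≤ p * q
*-nonNeg {p} {q} 0≤p 0≤q = nonNegative⁻¹ _ {{nonNeg*nonNeg⇒nonNeg p {{nonNegative 0≤p}} q {{nonNegative 0≤q}}}}

*-mono-≤-nonNeg : ∀ {p q r t} → 0ℚ ≤ p → 0ℚ ≤ r → p ≤ q → r ≤ t → p * r ≤ q * t
*-mono-≤-nonNeg {p} {q} {r} {t} 0≤p 0≤r p≤q r≤t =
  ≤-trans (*-monoʳ-≤-nonNeg r {{nonNegative 0≤r}} p≤q) (*-monoˡ-≤-nonNeg q {{nonNegative (≤-trans 0≤p p≤q)}} r≤t)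

p≤q⇒0≤q-p : ∀ {p q} → p ≤ q → 0ℚ ≤ q - p
p≤q⇒0≤q-p {p} {q} p≤q = subst (_≤ q - p) (+-inverseʳ p) (+-monoˡ-≤ (ℚ.- p) p≤q)

0≤p⇒q-p≤q : ∀ {p q} → 0ℚ ≤ p → q - p ≤ q
0≤p⇒q-p≤q {p} {q} 0≤p = subst (q - p ≤_) (+-identityʳ q) (+-monoʳ-≤ q (neg-antimono-≤ 0≤p))

ScaledBound : ℚ → ℕ → ℚ → Set
ScaledBound l d r = 0ℚ ≤ l × l * ι d ≤ r

pow-nonNeg : ∀ {y} k → 0ℚ ≤ y → 0ℚ ≤ pow y k
pow-nonNeg zero    _   = ≤ᵇ⇒≤ _
pow-nonNeg (suc k) 0≤y = *-nonNeg 0≤y (pow-nonNeg k 0≤y)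

ι-nonNeg : ∀ n → 0ℚ ≤ ι n
ι-nonNeg n = frac-nonNeg n 1

1≤two : 1ℚ ≤ two
1≤two = ≤ᵇ⇒≤ _

two≤three : two ≤ three
two≤three = ≤ᵇ⇒≤ _

module LocalFactorBound (s : ℕ) where

  p : ℕ
  p = suc (suc s)

  x a F : ℚ
  x = inv p
  a = 1ℚ - x
  F = frac (p ℕ.* p) (p ℕ.* p ℕ.∸ 1)

  0≤x : 0ℚ ≤ x
  0≤x = frac-nonNeg 1 p

  x≤1 : x ≤ 1ℚ
  x≤1 = frac-≤ 1 (suc s) 1 0 (s≤s z≤n)

  a≡ : a ≡ frac (suc s) p
  a≡ = begin
    1ℚ - x                    ≡⟨ cong (_- x) r/p+x≡1 ⟨
    (frac (suc s) p + x) - x  ≡⟨ +-assoc (frac (suc s) p) x (ℚ.- x) ⟩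
    frac (suc s) p + (x - x)  ≡⟨ cong (λ y → frac (suc s) p + y) (+-inverseʳ x) ⟩
    frac (suc s) p + 0ℚ       ≡⟨ +-identityʳ _ ⟩
    frac (suc s) p            ∎
    where
    open ≡-Reasoning
    r/p+x≡1 : frac (suc s) p + x ≡ 1ℚ
    r/p+x≡1 = trans (frac-+ (suc s) 1 (suc s)) (frac-cong (suc s ℕ.+ 1) (suc s) 1 0 (ℕ-Solver.solve (s ∷ [])))

  a*F≤1 : a * F ≤ 1ℚ
  a*F≤1 = subst (_≤ 1ℚ) (sym (trans (cong (_* F) a≡) (frac-* (suc s) (suc s) (p ℕ.* p) d)))
                (frac-≤ (suc s ℕ.* (p ℕ.* p)) (d ℕ.+ suc s ℕ.* suc d) 1 0
                  (subst (suc s ℕ.* (p ℕ.* p) ℕ.* 1 ℕ.≤_) (sym excess) (ℕP.m≤m+n _ _)))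
    where
    d : ℕ
    d = s ℕ.+ suc s ℕ.* p
    excess : 1 ℕ.* (p ℕ.* suc d) ≡ suc s ℕ.* (p ℕ.* p) ℕ.* 1 ℕ.+ suc s ℕ.* p
    excess = identity s
      where
      identity : ∀ s → 1 ℕ.* ((2 ℕ.+ s) ℕ.* (1 ℕ.+ (s ℕ.+ (1 ℕ.+ s) ℕ.* (2 ℕ.+ s))))
                     ≡ (1 ℕ.+ s) ℕ.* ((2 ℕ.+ s) ℕ.* (2 ℕ.+ s)) ℕ.* 1 ℕ.+ (1 ℕ.+ s) ℕ.* (2 ℕ.+ s)
      identity = ℕ-Solver.solve-∀

  0≤F : 0ℚ ≤ F
  0≤F = frac-nonNeg (p ℕ.* p) (p ℕ.* p ℕ.∸ 1)

  0≤z-y≤3 : ∀ {y z} → 0ℚ ≤ y → y ≤ z → z ≤ three → 0ℚ ≤ z - y × z - y ≤ three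
  0≤z-y≤3 0≤y y≤z z≤3 = p≤q⇒0≤q-p y≤z , ≤-trans (0≤p⇒q-p≤q 0≤y) z≤3

  0≤2x : 0ℚ ≤ two * x
  0≤2x = *-nonNeg (frac-nonNeg 2 1) 0≤x

  2x≤2 : two * x ≤ two
  2x≤2 = subst (two * x ≤_) (*-identityʳ two) (*-monoˡ-≤-nonNeg two x≤1)

  rhoBig≡x^[n+1]*a*c : ∀ n → 1 ℕ.≤ n →
    Σ[ c ∈ ℚ ] rhoBig p n ≡ pow x (suc n) * (a * c) × 0ℚ ≤ c × c ≤ three
  rhoBig≡x^[n+1]*a*c 1 _ = 1ℚ , cong (pow x 2 *_) (sym (*-identityʳ a)) , ≤ᵇ⇒≤ _ , ≤ᵇ⇒≤ _
  rhoBig≡x^[n+1]*a*c 2 _ = 1ℚ , cong (pow x 3 *_) (sym (*-identityʳ a)) , ≤ᵇ⇒≤ _ , ≤ᵇ⇒≤ _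
  rhoBig≡x^[n+1]*a*c 3 _ = a , refl , 0≤z-y≤3 0≤x x≤1 (≤ᵇ⇒≤ _)
  rhoBig≡x^[n+1]*a*c 4 _ = two - x , refl , 0≤z-y≤3 0≤x (≤-trans x≤1 1≤two) two≤three
  rhoBig≡x^[n+1]*a*c 5 _ = two - two * x , refl , 0≤z-y≤3 0≤2x 2x≤2 two≤three
  rhoBig≡x^[n+1]*a*c 6 _ = three - two * x , refl , 0≤z-y≤3 0≤2x (≤-trans 2x≤2 two≤three) ≤-refl
  rhoBig≡x^[n+1]*a*c 7 _ = three - two * x , refl , 0≤z-y≤3 0≤2x (≤-trans 2x≤2 two≤three) ≤-refl
  rhoBig≡x^[n+1]*a*c 8 _ = three - two * x , refl , 0≤z-y≤3 0≤2x (≤-trans 2x≤2 two≤three) ≤-refl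
  rhoBig≡x^[n+1]*a*c (suc (suc (suc (suc (suc (suc (suc (suc (suc _))))))))) _ =
    two - two * x , refl , 0≤z-y≤3 0≤2x 2x≤2 two≤three

  x^[n+1]*p^n≡x : ∀ n → pow x (suc n) * ι (p ℕ.^ n) ≡ x
  x^[n+1]*p^n≡x zero    = trans (*-identityʳ _) (*-identityʳ x)
  x^[n+1]*p^n≡x (suc n) = begin
    (x * pow x (suc n)) * ι (p ℕ.* p ℕ.^ n)           ≡⟨ cong ((x * pow x (suc n)) *_) (ι-* p (p ℕ.^ n)) ⟩
    (x * pow x (suc n)) * (ι p * ι (p ℕ.^ n))         ≡⟨ interchange x (pow x (suc n)) (ι p) (ι (p ℕ.^ n)) ⟩
    (x * ι p) * (pow x (suc n) * ι (p ℕ.^ n))         ≡⟨ cong₂ _*_ (inv*ι≡1 (suc s)) (x^[n+1]*p^n≡x n) ⟩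
    1ℚ * x                                            ≡⟨ *-identityˡ x ⟩
    x                                                 ∎
    where open ≡-Reasoning

  rhoBig-bound : ∀ n → 1 ℕ.≤ n → ScaledBound (rhoBig p n * F) (p ℕ.^ n) (three * x)
  rhoBig-bound n n≥1 with rhoBig≡x^[n+1]*a*c n n≥1
  ... | c , ρ≡ , 0≤c , c≤3 rewrite ρ≡ = *-nonNeg (*-nonNeg 0≤x^[n+1] (*-nonNeg 0≤a 0≤c)) 0≤F , (begin
    x^[n+1] * (a * c) * F * ι (p ℕ.^ n)   ≡⟨ regroup x^[n+1] a c F (ι (p ℕ.^ n)) ⟩
    x^[n+1] * ι (p ℕ.^ n) * (a * F * c)   ≡⟨ cong (_* (a * F * c)) (x^[n+1]*p^n≡x n) ⟩
    x * (a * F * c)                       ≤⟨ *-monoˡ-≤-nonNeg x {{nonNegative 0≤x}} aFc≤3 ⟩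
    x * three                             ≡⟨ *-comm x three ⟩
    three * x                             ∎)
    where
    open ≤-Reasoning
    open +-*-Solver
    x^[n+1] : ℚ
    x^[n+1] = pow x (suc n)
    0≤x^[n+1] : 0ℚ ≤ x^[n+1]
    0≤x^[n+1] = pow-nonNeg (suc n) 0≤x
    0≤a : 0ℚ ≤ a
    0≤a = p≤q⇒0≤q-p x≤1
    aFc≤3 : a * F * c ≤ three
    aFc≤3 = subst (a * F * c ≤_) (*-identityˡ three) (*-mono-≤-nonNeg (*-nonNeg 0≤a 0≤F) 0≤c a*F≤1 c≤3)
    regroup : ∀ y a c f i → y * (a * c) * f * i ≡ y * i * (a * f * c)
    regroup = solve 5 (λ y a c f i → y :* (a :* c) :* f :* i := y :* i :* (a :* f :* c)) refl

∏<-scaledBound : ∀ {f d g} N → (∀ q → ScaledBound (f q) (d q) (g q)) →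
                 ScaledBound (∏< f N) (ℕ∏.∏< d N) (∏< g N)
∏<-scaledBound zero    _     = ≤ᵇ⇒≤ _ , ≤ᵇ⇒≤ _
∏<-scaledBound {f} {d} {g} (suc N) bound with ∏<-scaledBound N bound | bound N
... | 0≤F , F*D≤G | 0≤f , f*d≤g = *-nonNeg 0≤F 0≤f , (begin
  ∏< f N * f N * ι (ℕ∏.∏< d N ℕ.* d N)       ≡⟨ cong (∏< f N * f N *_) (ι-* (ℕ∏.∏< d N) (d N)) ⟩
  ∏< f N * f N * (ι (ℕ∏.∏< d N) * ι (d N))   ≡⟨ interchange (∏< f N) (f N) (ι (ℕ∏.∏< d N)) (ι (d N)) ⟩
  ∏< f N * ι (ℕ∏.∏< d N) * (f N * ι (d N))   ≤⟨ *-mono-≤-nonNeg (*-nonNeg 0≤F (ι-nonNeg (ℕ∏.∏< d N)))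
                                                                 (*-nonNeg 0≤f (ι-nonNeg (d N))) F*D≤G f*d≤g ⟩
  ∏< g N * g N                               ∎)
  where open ≤-Reasoning

bigFactor : ℕ → ℕ → ℚ
bigFactor m q = rho q m * frac (q ℕ.* q) (q ℕ.* q ℕ.∸ 1)

bigFactorSel : ℕ → ℕ → ℚ
bigFactorSel m q = if does ((5 ℕ.≤? q) ×-dec (prime? q ×-dec q ∣? m)) then bigFactor m q else 1ℚ

lhsFactor : ℕ → ℕ → ℚ
lhsFactor m 2 = rho 2 m
lhsFactor m 3 = rho 3 m
lhsFactor m q = bigFactorSel m q

rhsFactor : ℕ → ℕ → ℚ
rhsFactor m q = if does (prime? q ×-dec q ∣? m) then three * inv q else 1ℚ

scaledBound-1 : ScaledBound 1ℚ 1 1ℚ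
scaledBound-1 = ≤ᵇ⇒≤ _ , ≤ᵇ⇒≤ _

scaledBound-prime : ∀ {m q} (r : ℕ → ℚ) → 1 ℕ.≤ m → Prime q →
  ScaledBound (r 0) 1 1ℚ → (∀ v → 1 ℕ.≤ v → ScaledBound (r v) (q ℕ.^ v) (three * inv q)) →
  ScaledBound (r (val q m)) (primeComponent m q) (rhsFactor m q)
scaledBound-prime {m} {q} r m≥1 q-prime r0 rv with prime? q | q ∣? m
... | no ¬q-prime | _ = contradiction q-prime ¬q-prime
... | yes _ | no q∤m rewrite val-∤ q∤m = r0
... | yes _ | yes q∣m = rv (val q m) (val-pos q-prime q∣m m≥1)

rho2-bound : ∀ v → 1 ℕ.≤ v → ScaledBound (rho2 v) (2 ℕ.^ v) (three * inv 2)
rho2-bound 1 _ = ≤ᵇ⇒≤ _ , ≤ᵇ⇒≤ _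
rho2-bound 2 _ = ≤ᵇ⇒≤ _ , ≤ᵇ⇒≤ _
rho2-bound v@(suc (suc (suc _))) _ = ≤-refl , subst (_≤ three * inv 2) (sym (*-zeroˡ (ι (2 ℕ.^ v)))) (≤ᵇ⇒≤ _)

rho3-bound : ∀ v → 1 ℕ.≤ v → ScaledBound (rho3 v) (3 ℕ.^ v) (three * inv 3)
rho3-bound v@(suc _) _ = ≤-refl , subst (_≤ three * inv 3) (sym (*-zeroˡ (ι (3 ℕ.^ v)))) (≤ᵇ⇒≤ _)

bigFactor-bound : ∀ {m q} → 5 ℕ.≤ q → 1 ℕ.≤ val q m → ScaledBound (bigFactor m q) (q ℕ.^ val q m) (three * inv q)
bigFactor-bound {m} {suc (suc (suc (suc (suc s))))} (s≤s (s≤s (s≤s (s≤s (s≤s _))))) =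
  LocalFactorBound.rhoBig-bound (3 ℕ.+ s) (val (5 ℕ.+ s) m)

-- For q = 5 + s the test `prime? q` in bigFactorSel m q is unfolded and a `with` on it
-- fails, so the case split below is done for a variable q after this rewriting.
bigFactorSel≡ : ∀ {m} q → 5 ℕ.≤ q → bigFactorSel m q ≡ (if does (prime? q ×-dec q ∣? m) then bigFactor m q else 1ℚ)
bigFactorSel≡ _ (s≤s (s≤s (s≤s (s≤s (s≤s _))))) = refl

bigFactorSel-bound : ∀ {m} → 1 ℕ.≤ m → ∀ q → 5 ℕ.≤ q → ScaledBound (bigFactorSel m q) (primeComponent m q) (rhsFactor m q)
bigFactorSel-bound {m} m≥1 q 5≤q =
  subst (λ l → ScaledBound l (primeComponent m q) (rhsFactor m q)) (sym (bigFactorSel≡ q 5≤q)) bound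
  where
  bound : ScaledBound (if does (prime? q ×-dec q ∣? m) then bigFactor m q else 1ℚ) (primeComponent m q) (rhsFactor m q)
  bound with prime? q | q ∣? m
  ... | no _        | _       = scaledBound-1
  ... | yes _       | no _    = scaledBound-1
  ... | yes q-prime | yes q∣m = bigFactor-bound 5≤q (val-pos q-prime q∣m m≥1)

lhsFactor-bound : ∀ {m} → 1 ℕ.≤ m → ∀ q → ScaledBound (lhsFactor m q) (primeComponent m q) (rhsFactor m q)
lhsFactor-bound m≥1 0 = scaledBound-1
lhsFactor-bound m≥1 1 = scaledBound-1
lhsFactor-bound m≥1 2 = scaledBound-prime rho2 m≥1 prime[2] (≤ᵇ⇒≤ _ , ≤ᵇ⇒≤ _) rho2-bound
lhsFactor-bound m≥1 3 = scaledBound-prime rho3 m≥1 (toWitness {a? = prime? 3} _) (≤ᵇ⇒≤ _ , ≤ᵇ⇒≤ _) rho3-bound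
lhsFactor-bound m≥1 4 = scaledBound-1
lhsFactor-bound m≥1 q@(suc (suc (suc (suc (suc _))))) = bigFactorSel-bound m≥1 q (s≤s (s≤s (s≤s (s≤s (s≤s z≤n)))))

∏<-lhsFactor : ∀ m k → ∏< (lhsFactor m) (4 ℕ.+ k) ≡ rho 2 m * (rho 3 m * ∏< (bigFactorSel m) (4 ℕ.+ k))
∏<-lhsFactor m zero    = solve 2 (λ ρ₂ ρ₃ → ((con 1ℚ :* con 1ℚ) :* con 1ℚ :* ρ₂) :* ρ₃
                                 := ρ₂ :* (ρ₃ :* ((((con 1ℚ :* con 1ℚ) :* con 1ℚ) :* con 1ℚ) :* con 1ℚ)))
                                 refl (rho 2 m) (rho 3 m)
  where open +-*-Solver
∏<-lhsFactor m (suc k) = begin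
  ∏< (lhsFactor m) (4 ℕ.+ k) * bigFactorSel m (4 ℕ.+ k) ≡⟨ cong (_* bigFactorSel m (4 ℕ.+ k)) (∏<-lhsFactor m k) ⟩
  ρ₂ * (ρ₃ * S) * s                                   ≡⟨ *-assoc ρ₂ _ s ⟩
  ρ₂ * (ρ₃ * S * s)                                   ≡⟨ cong (ρ₂ *_) (*-assoc ρ₃ S s) ⟩
  ρ₂ * (ρ₃ * (S * s))                                 ∎
  where
  open ≡-Reasoning
  ρ₂ ρ₃ S s : ℚ
  ρ₂ = rho 2 m
  ρ₃ = rho 3 m
  S = ∏< (bigFactorSel m) (4 ℕ.+ k)
  s = bigFactorSel m (4 ℕ.+ k)

-- The range 4 + m contains 2 and 3 even when m < 3.
LHS≡∏< : ∀ {m} → 1 ℕ.≤ m → LHS m ≡ ∏< (lhsFactor m) (4 ℕ.+ m)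
LHS≡∏< {m} m≥1 = begin
  rho 2 m * (rho 3 m * prodℚ (map (bigFactor m) (filter BPD? (upTo (suc m)))))
    ≡⟨ cong (λ P → rho 2 m * (rho 3 m * P)) (ℚ∏.foldr-filter-upTo BPD? (bigFactor m) (4 ℕ.+ m) (ℕP.m≤n+m (suc m) 3)
         λ q m<q (_ , _ , q∣m) → >⇒∤ {{ℕ.>-nonZero m≥1}} m<q q∣m) ⟩
  rho 2 m * (rho 3 m * ∏< (bigFactorSel m) (4 ℕ.+ m))
    ≡⟨ ∏<-lhsFactor m m ⟨
  ∏< (lhsFactor m) (4 ℕ.+ m)
    ∎
  where
  open ≡-Reasoning
  BPD? : Decidable (λ p → 5 ℕ.≤ p × Prime p × p ∣ m)
  BPD? p = (5 ℕ.≤? p) ×-dec (prime? p ×-dec (p ∣? m))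

RHS≡∏< : ∀ {m} → 1 ℕ.≤ m → RHS m ≡ inv m * ∏< (rhsFactor m) (4 ℕ.+ m)
RHS≡∏< {m} m≥1 = cong (inv m *_) (ℚ∏.foldr-filter-upTo (λ p → prime? p ×-dec (p ∣? m)) (λ p → three * inv p)
  (4 ℕ.+ m) (ℕP.m≤n+m (suc m) 3) λ q m<q (_ , q∣m) → >⇒∤ {{ℕ.>-nonZero m≥1}} m<q q∣m)

LHS≤RHS : ∀ m → 1 ℕ.≤ m → LHS m ≤ RHS m
LHS≤RHS m@(suc n) m≥1 = begin
  LHS m                 ≡⟨ LHS≡∏< m≥1 ⟩
  L                     ≡⟨ cancel ⟨
  inv m * (L * ι m)     ≤⟨ *-monoˡ-≤-nonNeg (inv m) {{nonNegative (frac-nonNeg 1 m)}} L*m≤R ⟩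
  inv m * R             ≡⟨ RHS≡∏< m≥1 ⟨
  RHS m                 ∎
  where
  open ≤-Reasoning
  N : ℕ
  N = 4 ℕ.+ m
  L R : ℚ
  L = ∏< (lhsFactor m) N
  R = ∏< (rhsFactor m) N
  cancel : inv m * (L * ι m) ≡ L
  cancel = trans (x∙yz≈y∙xz (inv m) L (ι m)) (trans (cong (L *_) (inv*ι≡1 n)) (*-identityʳ L))
  L*m≤R : L * ι m ≤ R
  L*m≤R = subst (λ k → L * ι k ≤ R) (∏<-primeComponent N m≥1 (ℕP.m≤n+m (suc m) 3))
                (proj₂ (∏<-scaledBound N (lhsFactor-bound m≥1)))

lemma6p2 : Σ ℚ (λ C → (0ℚ < C) × ((m : ℕ) → m ≥ 1 → LHS m ≤ C * RHS m))
lemma6p2 = 1ℚ , positive⁻¹ 1ℚ , λ m m≥1 → subst (LHS m ≤_) (sym (*-identityˡ (RHS m))) (LHS≤RHS m m≥1)
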